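{- Let $F$ be a connected graph with maximum degree at most $3$ and let $V_1(F)$ be its set of vertices of degree $1$. If $|V_1(F)| \ge 2$, then $F$ contains $\lfloor |V_1(F)|/2 \rfloor$ pairwise vertex-disjoint paths all of whose end-vertices lie in $V_1(F)$.
   Context: Graphs are finite and simple. -}

module Defs where

open import Data.Nat using (ℕ; _≤_)
open import Data.Bool using (Bool; true; false; T)
open import Data.Fin using (Fin)
open import Data.List using (List; []; _∷_; _∷ʳ_; length; filter; allFin)
open import Data.List.Relation.Unary.Linked using (Linked)
open import Data.List.Relation.Unary.Unique.Propositional using (Unique)
open import Data.List.Membership.Propositional using (_∈_)
open import Relation.Binary.PropositionalEquality using (_≡_)
open import Data.Product using (Σ; _×_)
open import Relation.Nullary using (¬_)
import Data.Nat as ℕ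

record Graph (n : ℕ) : Set where
  field
    adj    : Fin n → Fin n → Bool
    sym    : ∀ u v → adj u v ≡ adj v u
    irrefl : ∀ v → adj v v ≡ false

module _ {n : ℕ} (G : Graph n) where
  open Graph G

  Adj : Fin n → Fin n → Set
  Adj u v = adj u v ≡ true

  deg : Fin n → ℕ
  deg v = length (filter (λ w → adj v w Data.Bool.≟ true) (allFin n))

  MaxDegreeAtMost : ℕ → Set
  MaxDegreeAtMost k = ∀ v → deg v ≤ k

  data Walk : Fin n → Fin n → Set where
    stay : ∀ {v} → Walk v v
    step : ∀ {u w v} → Adj u w → Walk w v → Walk u v

  Connected : Set
  Connected = ∀ u v → Walk u v

  V₁ : List (Fin n)
  V₁ = filter (λ v → deg v ℕ.≟ 1) (allFin n)

  record Path : Set where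
    field
      start : Fin n
      inner : List (Fin n)
      end   : Fin n
    vertices : List (Fin n)
    vertices = (start ∷ inner) ∷ʳ end
    field
      linked : Linked Adj vertices
      unique : Unique vertices

  open Path public

  EndsInV₁ : Path → Set
  EndsInV₁ P = deg (start P) ≡ 1 × deg (end P) ≡ 1

  DisjointV₁Paths : ℕ → Set
  DisjointV₁Paths k =
    Σ (Fin k → Path) λ P →
      (∀ i → EndsInV₁ (P i)) ×
      (∀ i j v → v ∈ vertices (P i) → v ∈ vertices (P j) → i ≡ j)

-- Root a breadth-first spanning tree of F at a leaf r and pack it from the bottom up. A packing
-- of the subtree of v consists of vertex-disjoint paths joining leaves of F together with at most
-- one pending chain from v down to a leaf, such that every leaf of the subtree other than r ends
-- one of them. At v the pending chains of the children are collected: if there is none, a leaf v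
-- is its own pending chain; a single one is extended by v; two are joined through v into a new
-- path. Three cannot occur, since v has at most two children: its degree is at most 3 and every
-- vertex but r also has a parent, while r has degree 1. At the root a nontrivial pending chain is a
-- path, as r is a leaf; so all leaves but r are ends of disjoint paths, and |V₁| ≤ 1 + 2 · #paths.

module Submission where

open import Defs
open import Data.Nat using (ℕ; zero; suc; _+_; _≤_; _<_; z≤n; s≤s; ⌊_/2⌋)
open import Data.Nat.Properties
  using ( ≤-refl; ≤-reflexive; ≤-trans; ≤-antisym; ≤-pred; n≤1+n; n<1+n; m≤n+m; n≤0⇒n≡0; <-irrefl; <⇒≱
        ; +-suc; +-identityʳ; +-mono-≤; suc-injective; m≢1+n+m; ⌊n/2⌋-mono; module ≤-Reasoning)
open import Data.Bool using (true)
import Data.Bool as Bool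
import Data.Nat as ℕ
open import Data.Fin using (Fin; _≟_; inject≤)
open import Data.Fin.Properties using (inject≤-injective)
open import Data.List
  using (List; []; _∷_; _++_; _∷ʳ_; _ʳ++_; length; reverse; filter; allFin; map; concatMap; lookup)
open import Data.List.Properties
  using (ʳ++-defn; ++-assoc; ++-identityʳ; length-++; length-map; concatMap-++; concatMap-map)
open import Data.List.Relation.Unary.All as All using (All; []; _∷_)
open import Data.List.Relation.Unary.All.Properties using (all-filter)
import Data.List.Relation.Unary.All.Properties as All
import Data.List.Relation.Unary.Any.Properties as Any
open import Data.List.Relation.Unary.Any as Any using (Any; here; there; any?)
open import Data.List.Relation.Unary.Linked using (Linked; []; [-]; _∷_)
open import Data.List.Relation.Unary.AllPairs using ([]; _∷_)
open import Data.List.Relation.Unary.Unique.Propositional using (Unique)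
import Data.List.Relation.Unary.Unique.Propositional.Properties as Unique
open import Data.List.Relation.Binary.Disjoint.Propositional using (Disjoint)
open import Data.List.Relation.Binary.Subset.Propositional using (_⊆_)
open import Data.List.Relation.Binary.Permutation.Propositional
  using (_↭_; ↭-sym; ↭-trans; ↭-reflexive; ↭⇒↭ₛ; module PermutationReasoning)
open import Data.List.Relation.Binary.Permutation.Propositional.Properties
  using (shift; ↭-length; ↭-reverse; ++⁺ˡ; ++⁺ʳ; ++-comm; ++-commutativeMonoid; ∈-resp-↭)
import Data.List.Relation.Binary.Permutation.Setoid.Properties as Permutationₛ
open import Algebra.Bundles using (CommutativeMonoid)
import Algebra.Properties.CommutativeSemigroup as CommutativeSemigroupProperties
open import Data.List.Membership.Propositional using (_∈_; find; lose)
open import Data.List.Membership.Propositional.Properties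
  using (∈-∃++; ∈-++⁺ˡ; ∈-++⁺ʳ; ∈-++⁻; ∈-allFin; ∈-filter⁺; ∈-filter⁻; ∈-map⁺; ∈-concat⁺′; ∈-lookup)
open import Data.List.Extrema.Nat using (argmax; f[xs]≤f[argmax])
open import Data.Product using (Σ-syntax; ∃; _×_; _,_; proj₁; proj₂)
open import Data.Sum using (_⊎_; inj₁; inj₂; [_,_]′)
import Data.Sum as Sum
open import Function using (_∘_; id)
open import Relation.Binary.Construct.Closure.ReflexiveTransitive using (Star; ε; _◅_; _◅◅_)
open import Relation.Binary.PropositionalEquality
  using (_≡_; _≢_; refl; sym; trans; cong; cong₂; subst; setoid; module ≡-Reasoning)
open import Relation.Nullary using (Dec; yes; no; ¬?; contradiction)
open import Relation.Nullary.Decidable using (map′; _×-dec_; _⊎-dec_)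
open import Relation.Unary using (Decidable)
open import Relation.Binary.Definitions using (Symmetric)

module _ {A : Set} where

  Unique-++⁻ : ∀ xs {ys : List A} → Unique (xs ++ ys) → Unique xs × Unique ys × Disjoint xs ys
  Unique-++⁻ [] u = [] , u , λ ()
  Unique-++⁻ (x ∷ xs) (x∉ ∷ u) with Unique-++⁻ xs u | All.++⁻ xs x∉
  ... | uxs , uys , xs#ys | x∉xs , x∉ys = x∉xs ∷ uxs , uys , λ
    { (here refl , x∈ys) → All.lookup x∉ys x∈ys refl
    ; (there y∈xs , y∈ys) → xs#ys (y∈xs , y∈ys)
    }

  0<length⇒∃∈ : ∀ {xs : List A} → 0 < length xs → ∃ (_∈ xs)
  0<length⇒∃∈ {x ∷ _} _ = x , here refl

  Unique∧⊆⇒length≤ : ∀ {xs ys : List A} → Unique xs → xs ⊆ ys → length xs ≤ length ys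
  Unique∧⊆⇒length≤ {[]} _ _ = z≤n
  Unique∧⊆⇒length≤ {x ∷ xs} (x∉xs ∷ uxs) xs⊆ys with as , bs , refl ← ∈-∃++ (xs⊆ys (here refl)) = begin
    suc (length xs)          ≤⟨ s≤s (Unique∧⊆⇒length≤ uxs xs⊆as++bs) ⟩
    suc (length (as ++ bs))  ≡⟨ ↭-length (shift x as bs) ⟨
    length (as ++ x ∷ bs)    ∎
    where
    open ≤-Reasoning
    xs⊆as++bs : xs ⊆ as ++ bs
    xs⊆as++bs y∈xs with ∈-++⁻ as (xs⊆ys (there y∈xs))
    ... | inj₁ y∈as         = ∈-++⁺ˡ y∈as
    ... | inj₂ (here refl)  = contradiction refl (All.lookup x∉xs y∈xs)
    ... | inj₂ (there y∈bs) = ∈-++⁺ʳ as y∈bs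

  Linked-ʳ++ : ∀ {R : A → A → Set} → Symmetric R →
    ∀ {x} xs {ys} → Linked R (x ∷ xs) → Linked R (x ∷ ys) → Linked R (xs ʳ++ x ∷ ys)
  Linked-ʳ++ R-sym []       _         x∷ys = x∷ys
  Linked-ʳ++ R-sym (y ∷ xs) (xy ∷ y∷xs) x∷ys = Linked-ʳ++ R-sym xs y∷xs (R-sym xy ∷ x∷ys)

  last⁺ : A → List A → A
  last⁺ x []       = x
  last⁺ _ (y ∷ ys) = last⁺ y ys

  init⁺ : A → List A → List A
  init⁺ _ []       = []
  init⁺ x (y ∷ ys) = x ∷ init⁺ y ys

  init⁺-∷ʳ-last⁺ : ∀ x xs → init⁺ x xs ∷ʳ last⁺ x xs ≡ x ∷ xs
  init⁺-∷ʳ-last⁺ x []       = refl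
  init⁺-∷ʳ-last⁺ x (y ∷ ys) = cong (x ∷_) (init⁺-∷ʳ-last⁺ y ys)

  ʳ++-last⁺ : ∀ x xs {ys} → (x ∷ xs) ʳ++ ys ≡ last⁺ x xs ∷ (init⁺ x xs ʳ++ ys)
  ʳ++-last⁺ x []       = refl
  ʳ++-last⁺ x (y ∷ xs) = ʳ++-last⁺ y xs

  ʳ++-++ : ∀ xs {ys zs : List A} → (xs ʳ++ ys) ++ zs ≡ xs ʳ++ (ys ++ zs)
  ʳ++-++ xs {ys} {zs} = begin
    (xs ʳ++ ys) ++ zs          ≡⟨ cong (_++ zs) (ʳ++-defn xs) ⟩
    (reverse xs ++ ys) ++ zs   ≡⟨ ++-assoc (reverse xs) ys zs ⟩
    reverse xs ++ (ys ++ zs)   ≡⟨ ʳ++-defn xs ⟨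
    xs ʳ++ (ys ++ zs)          ∎
    where open ≡-Reasoning

  ʳ++-∷-ends : ∀ x xs v y ys →
    (last⁺ x xs ∷ (init⁺ x xs ʳ++ v ∷ init⁺ y ys)) ∷ʳ last⁺ y ys ≡ (x ∷ xs) ʳ++ v ∷ y ∷ ys
  ʳ++-∷-ends x xs v y ys = begin
    (last⁺ x xs ∷ (init⁺ x xs ʳ++ v ∷ init⁺ y ys)) ∷ʳ last⁺ y ys
      ≡⟨ cong (last⁺ x xs ∷_) (ʳ++-++ (init⁺ x xs)) ⟩
    last⁺ x xs ∷ (init⁺ x xs ʳ++ v ∷ (init⁺ y ys ∷ʳ last⁺ y ys))
      ≡⟨ cong (λ zs → last⁺ x xs ∷ (init⁺ x xs ʳ++ v ∷ zs)) (init⁺-∷ʳ-last⁺ y ys) ⟩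
    last⁺ x xs ∷ (init⁺ x xs ʳ++ v ∷ y ∷ ys)
      ≡⟨ ʳ++-last⁺ x xs ⟨
    (x ∷ xs) ʳ++ v ∷ y ∷ ys
      ∎
    where open ≡-Reasoning

  Unique-resp-↭ : ∀ {xs ys : List A} → xs ↭ ys → Unique xs → Unique ys
  Unique-resp-↭ = Permutationₛ.Unique-resp-↭ (setoid A) ∘ ↭⇒↭ₛ

  ʳ++-↭ : ∀ xs {ys : List A} → xs ʳ++ ys ↭ xs ++ ys
  ʳ++-↭ xs {ys} = ↭-trans (↭-reflexive (ʳ++-defn xs)) (++⁺ʳ ys (↭-reverse xs))

  ʳ++-∷-↭ : ∀ xs (v : A) ys → xs ʳ++ v ∷ ys ↭ v ∷ xs ++ ys
  ʳ++-∷-↭ xs v ys = ↭-trans (ʳ++-↭ xs) (shift v xs ys)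

  ++-interchange : ∀ (as bs cs ds : List A) → (as ++ bs) ++ (cs ++ ds) ↭ (as ++ cs) ++ (bs ++ ds)
  ++-interchange = CommutativeSemigroupProperties.interchange
    (CommutativeMonoid.commutativeSemigroup (++-commutativeMonoid {A = A}))

  lookup-Disjoint : ∀ {B : Set} (f : B → List A) (bs : List B) → Unique (concatMap f bs) →
    ∀ {a} i j → a ∈ f (lookup bs i) → a ∈ f (lookup bs j) → i ≡ j
  lookup-Disjoint f (b ∷ bs) u Fin.zero Fin.zero _ _ = refl
  lookup-Disjoint f (b ∷ bs) u Fin.zero (Fin.suc j) a∈b a∈bⱼ =
    contradiction (a∈b , ∈-concat⁺′ a∈bⱼ (∈-map⁺ f (∈-lookup {xs = bs} j)))
                  (proj₂ (proj₂ (Unique-++⁻ (f b) u)))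
  lookup-Disjoint f (b ∷ bs) u (Fin.suc i) Fin.zero a∈bᵢ a∈b =
    sym (lookup-Disjoint f (b ∷ bs) u Fin.zero (Fin.suc i) a∈b a∈bᵢ)
  lookup-Disjoint f (b ∷ bs) u (Fin.suc i) (Fin.suc j) a∈bᵢ a∈bⱼ =
    cong Fin.suc (lookup-Disjoint f bs (proj₁ (proj₂ (Unique-++⁻ (f b) u))) i j a∈bᵢ a∈bⱼ)

least-solution : ∀ {P : ℕ → Set} → Decidable P → ∀ m → P m → Σ[ k ∈ ℕ ] P k × (∀ {j} → P j → k ≤ j)
least-solution P? zero p0 = zero , p0 , λ _ → z≤n
least-solution P? (suc m) pm with P? zero
... | yes p0 = zero , p0 , λ _ → z≤n
... | no ¬p0 with least-solution (P? ∘ suc) m pm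
...   | k , pk , minimal = suc k , pk , λ { {zero} p0 → contradiction p0 ¬p0 ; {suc j} pj → s≤s (minimal pj) }

⌊1+n+n/2⌋≡n : ∀ n → ⌊ suc (n + n) /2⌋ ≡ n
⌊1+n+n/2⌋≡n zero = refl
⌊1+n+n/2⌋≡n (suc n) rewrite +-suc n n = cong suc (⌊1+n+n/2⌋≡n n)

module _ {n : ℕ} (F : Graph n) where

  Leaf : Fin n → Set
  Leaf v = deg F v ≡ 1

  Adj-sym : ∀ {u v} → Adj F u v → Adj F v u
  Adj-sym {u} {v} uv = trans (Graph.sym F v u) uv

  Unique∧All-Adj⇒length≤deg : ∀ {v xs} → Unique xs → All (Adj F v) xs → length xs ≤ deg F v
  Unique∧All-Adj⇒length≤deg {v} uxs adj = Unique∧⊆⇒length≤ uxs λ w∈xs →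
    ∈-filter⁺ (λ w → Graph.adj F v w Bool.≟ true) (∈-allFin _) (All.lookup adj w∈xs)

  pathVertices : List (Path F) → List (Fin n)
  pathVertices = concatMap vertices

  pathEnds : List (Path F) → List (Fin n)
  pathEnds []       = []
  pathEnds (P ∷ Ps) = start P ∷ end P ∷ pathEnds Ps

  IsEndOf : Fin n → Path F → Set
  IsEndOf w P = w ≡ start P ⊎ w ≡ end P

  Any-IsEndOf⇒∈-pathEnds : ∀ {w Ps} → Any (IsEndOf w) Ps → w ∈ pathEnds Ps
  Any-IsEndOf⇒∈-pathEnds (here (inj₁ refl)) = here refl
  Any-IsEndOf⇒∈-pathEnds (here (inj₂ refl)) = there (here refl)
  Any-IsEndOf⇒∈-pathEnds (there w∈Ps)       = there (there (Any-IsEndOf⇒∈-pathEnds w∈Ps))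

  length-pathEnds : ∀ Ps → length (pathEnds Ps) ≡ length Ps + length Ps
  length-pathEnds []       = refl
  length-pathEnds (P ∷ Ps) = cong suc (trans (cong suc (length-pathEnds Ps)) (sym (+-suc _ _)))

  toPath : ∀ s inner e {xs} → (s ∷ inner) ∷ʳ e ≡ xs → Linked (Adj F) xs → Unique xs → Path F
  toPath s inner e shape linked unique = record
    { start = s ; inner = inner ; end = e
    ; linked = subst (Linked (Adj F)) (sym shape) linked
    ; unique = subst Unique (sym shape) unique
    }

  fromList⇒DisjointV₁Paths : ∀ {k} Ps → All (EndsInV₁ F) Ps → Unique (pathVertices Ps) → k ≤ length Ps →
    DisjointV₁Paths F k
  fromList⇒DisjointV₁Paths Ps ends disjoint k≤ =
    (λ i → lookup Ps (inject≤ i k≤)) ,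
    (λ i → All.lookup ends (∈-lookup (inject≤ i k≤))) ,
    λ i j v v∈Pᵢ v∈Pⱼ → inject≤-injective k≤ k≤ i j (lookup-Disjoint vertices Ps disjoint _ _ v∈Pᵢ v∈Pⱼ)

  ∈-V₁⇒Leaf : ∀ {w} → w ∈ V₁ F → Leaf w
  ∈-V₁⇒Leaf = proj₂ ∘ ∈-filter⁻ (λ v → deg F v ℕ.≟ 1) {xs = allFin n}

  covering-all-leaves-but-one⇒DisjointV₁Paths : ∀ r Ps → All (EndsInV₁ F) Ps → Unique (pathVertices Ps) →
    (∀ {w} → Leaf w → w ≢ r → Any (IsEndOf w) Ps) → DisjointV₁Paths F ⌊ length (V₁ F) /2⌋
  covering-all-leaves-but-one⇒DisjointV₁Paths r Ps ends disjoint covered =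
    fromList⇒DisjointV₁Paths Ps ends disjoint (begin
      ⌊ length (V₁ F) /2⌋                ≤⟨ ⌊n/2⌋-mono |V₁|≤1+2|Ps| ⟩
      ⌊ suc (length Ps + length Ps) /2⌋  ≡⟨ ⌊1+n+n/2⌋≡n (length Ps) ⟩
      length Ps                          ∎)
    where
    open ≤-Reasoning

    V₁⊆r∷ends : V₁ F ⊆ r ∷ pathEnds Ps
    V₁⊆r∷ends {w} w∈V₁ with w ≟ r
    ... | yes refl = here refl
    ... | no w≢r  = there (Any-IsEndOf⇒∈-pathEnds (covered (∈-V₁⇒Leaf w∈V₁) w≢r))

    |V₁|≤1+2|Ps| : length (V₁ F) ≤ suc (length Ps + length Ps)
    |V₁|≤1+2|Ps| = ≤-trans (Unique∧⊆⇒length≤ (Unique.filter⁺ _ (Unique.allFin⁺ n)) V₁⊆r∷ends)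
                           (≤-reflexive (cong suc (length-pathEnds Ps)))

module BreadthFirstTree {n : ℕ} (F : Graph n) (connected : Connected F) (r : Fin n) where

  data Within : ℕ → Fin n → Set where
    root : ∀ {k} → Within k r
    step : ∀ {k v w} → Adj F v w → Within k w → Within (suc k) v

  within? : ∀ k v → Dec (Within k v)
  within? zero v = map′ (λ { refl → root }) (λ { root → refl }) (v ≟ r)
  within? (suc k) v = map′ [ (λ { refl → root }) , via-neighbour ]′ root-or-neighbour
    ((v ≟ r) ⊎-dec any? (λ w → (Graph.adj F v w Bool.≟ true) ×-dec within? k w) (allFin n))
    where
    via-neighbour : Any (λ w → Adj F v w × Within k w) (allFin n) → Within (suc k) v
    via-neighbour ∃w with _ , _ , vw , w-within ← find ∃w = step vw w-within

    root-or-neighbour : Within (suc k) v → v ≡ r ⊎ Any (λ w → Adj F v w × Within k w) (allFin n)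
    root-or-neighbour root                = inj₁ refl
    root-or-neighbour (step vw w-within) = inj₂ (lose (∈-allFin _) (vw , w-within))

  walk⇒within : ∀ {v} → Walk F v r → ∃ λ k → Within k v
  walk⇒within stay = 0 , root
  walk⇒within (step vw walk) with k , w-within ← walk⇒within walk = suc k , step vw w-within

  depth-spec : ∀ v → Σ[ k ∈ ℕ ] Within k v × (∀ {j} → Within j v → k ≤ j)
  depth-spec v with k , v-within ← walk⇒within (connected v r) = least-solution (λ j → within? j v) k v-within

  depth : Fin n → ℕ
  depth v = proj₁ (depth-spec v)

  within-depth : ∀ v → Within (depth v) v
  within-depth v = proj₁ (proj₂ (depth-spec v))

  depth-minimal : ∀ {j v} → Within j v → depth v ≤ j
  depth-minimal {v = v} = proj₂ (proj₂ (depth-spec v))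

  parent-spec : ∀ {v} → v ≢ r → Σ[ p ∈ Fin n ] Adj F v p × depth v ≡ suc (depth p)
  parent-spec {v} v≢r = descend (within-depth v) refl
    where
    descend : ∀ {k} → Within k v → depth v ≡ k → Σ[ p ∈ Fin n ] Adj F v p × depth v ≡ suc (depth p)
    descend root _ = contradiction refl v≢r
    descend (step {w = w} vw w-within) depth-v≡1+k = w , vw ,
      ≤-antisym (depth-minimal (step vw (within-depth w)))
                (subst (suc (depth w) ≤_) (sym depth-v≡1+k) (s≤s (depth-minimal w-within)))

  -- the root is its own parent, a junk value that Child rules out
  parent : Fin n → Fin n
  parent v with v ≟ r
  ... | yes _   = v
  ... | no v≢r = proj₁ (parent-spec v≢r)

  parent-adj : ∀ {v} → v ≢ r → Adj F v (parent v)
  parent-adj {v} v≢r with v ≟ r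
  ... | yes v≡r  = contradiction v≡r v≢r
  ... | no v≢r′ = proj₁ (proj₂ (parent-spec v≢r′))

  depth-parent : ∀ {v} → v ≢ r → depth v ≡ suc (depth (parent v))
  depth-parent {v} v≢r with v ≟ r
  ... | yes v≡r  = contradiction v≡r v≢r
  ... | no v≢r′ = proj₂ (proj₂ (parent-spec v≢r′))

  height : ℕ
  height = depth (argmax depth r (allFin n))

  depth≤height : ∀ v → depth v ≤ height
  depth≤height v = All.lookup (f[xs]≤f[argmax] r (allFin n)) (∈-allFin v)

  Child : Fin n → Fin n → Set
  Child v c = c ≢ r × parent c ≡ v

  child? : ∀ v c → Dec (Child v c)
  child? v c = ¬? (c ≟ r) ×-dec (parent c ≟ v)

  children : Fin n → List (Fin n)
  children v = filter (child? v) (allFin n)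

  All-Child-children : ∀ v → All (Child v) (children v)
  All-Child-children v = all-filter (child? v) (allFin n)

  Child⇒∈-children : ∀ {v c} → Child v c → c ∈ children v
  Child⇒∈-children {v} = ∈-filter⁺ (child? v) (∈-allFin _)

  Unique-children : ∀ v → Unique (children v)
  Unique-children v = Unique.filter⁺ (child? v) (Unique.allFin⁺ n)

  child-adj : ∀ {v c} → Child v c → Adj F v c
  child-adj (c≢r , refl) = Adj-sym F (parent-adj c≢r)

  child-depth : ∀ {v c} → Child v c → depth c ≡ suc (depth v)
  child-depth (c≢r , refl) = depth-parent c≢r

  length-children≤deg : ∀ v → length (children v) ≤ deg F v
  length-children≤deg v =
    Unique∧All-Adj⇒length≤deg F (Unique-children v) (All.map child-adj (All-Child-children v))

  1+length-children≤deg : ∀ {v} → v ≢ r → suc (length (children v)) ≤ deg F v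
  1+length-children≤deg {v} v≢r = Unique∧All-Adj⇒length≤deg F
    (All.tabulate parent≢child ∷ Unique-children v)
    (parent-adj v≢r ∷ All.map child-adj (All-Child-children v))
    where
    parent≢child : ∀ {c} → c ∈ children v → parent v ≢ c
    parent≢child c∈ refl = m≢1+n+m (depth v)
      (trans (depth-parent v≢r) (cong suc (child-depth (All.lookup (All-Child-children v) c∈))))

  Descendant : Fin n → Fin n → Set
  Descendant = Star Child

  descendant-depth : ∀ {v w} → Descendant v w → depth v ≤ depth w
  descendant-depth ε          = ≤-refl
  descendant-depth (vc ◅ cw) = ≤-trans (n≤1+n _) (subst (_≤ _) (child-depth vc) (descendant-depth cw))

  child-descendant-depth : ∀ {v c w} → Child v c → Descendant c w → depth v < depth w
  child-descendant-depth vc cw = subst (_≤ _) (child-depth vc) (descendant-depth cw)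

  descendant-unique : ∀ {u v w} → Descendant u w → Descendant v w → depth u ≡ depth v → u ≡ v
  descendant-unique ε ε _ = refl
  descendant-unique ε (vc ◅ cw) du≡dv = contradiction (child-descendant-depth vc cw) (<-irrefl (sym du≡dv))
  descendant-unique (uc ◅ cw) ε du≡dv = contradiction (child-descendant-depth uc cw) (<-irrefl du≡dv)
  descendant-unique (uc ◅ cw) (vc′ ◅ c′w) du≡dv
    with refl ← descendant-unique cw c′w
                  (trans (child-depth uc) (trans (cong suc du≡dv) (sym (child-depth vc′)))) =
    trans (sym (proj₂ uc)) (proj₂ vc′)

  root-descendant : ∀ w → Descendant r w
  root-descendant w = go (depth w) w refl
    where
    go : ∀ k w → depth w ≡ k → Descendant r w
    go k w _ with w ≟ r
    ... | yes refl = ε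
    go zero w depth≡0 | no w≢r with () ← trans (sym (depth-parent w≢r)) depth≡0
    go (suc k) w depth≡1+k | no w≢r =
      go k (parent w) (suc-injective (trans (sym (depth-parent w≢r)) depth≡1+k)) ◅◅ ((w≢r , refl) ◅ ε)

  descendant-split : ∀ {v w} → Descendant v w → w ≡ v ⊎ Any (λ c → Descendant c w) (children v)
  descendant-split ε          = inj₁ refl
  descendant-split (vc ◅ cw) = inj₂ (lose (Child⇒∈-children vc) cw)

  proper-descendant : ∀ {v w} → Any (λ c → Descendant c w) (children v) → Descendant v w × w ≢ v
  proper-descendant {v} ∃c with c , c∈ , cw ← find ∃c =
    let vc = All.lookup (All-Child-children v) c∈ in
    vc ◅ cw , λ { refl → <-irrefl refl (child-descendant-depth vc cw) }

module GreedyPacking {n : ℕ} (F : Graph n) (connected : Connected F) (maxDeg≤3 : MaxDegreeAtMost F 3)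
                     (r : Fin n) (r-leaf : Leaf F r) where

  open BreadthFirstTree F connected r

  length-children≤2 : ∀ v → length (children v) ≤ 2
  length-children≤2 v with v ≟ r
  ... | yes refl = ≤-trans (length-children≤deg r) (≤-trans (≤-reflexive r-leaf) (s≤s z≤n))
  ... | no v≢r  = ≤-pred (≤-trans (1+length-children≤deg v≢r) (maxDeg≤3 v))

  leaf-childless : ∀ {v} → Leaf F v → v ≢ r → length (children v) ≡ 0
  leaf-childless {v} v-leaf v≢r =
    n≤0⇒n≡0 (≤-pred (subst (suc (length (children v)) ≤_) v-leaf (1+length-children≤deg v≢r)))

  record Chain (v : Fin n) : Set where
    constructor mkChain
    field
      below  : List (Fin n)
      linked : Linked (Adj F) (v ∷ below)
    bottom : Fin n
    bottom = last⁺ v below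
    field
      leaf : Leaf F bottom

  chainVertices : ∀ {v} → Chain v → List (Fin n)
  chainVertices {v} C = v ∷ Chain.below C

  record Hanging (v : Fin n) : Set where
    constructor mkHanging
    field
      {top} : Fin n
      adj   : Adj F v top
      chain : Chain top

  extend : ∀ {v} → Hanging v → Chain v
  extend (mkHanging vt (mkChain below linked leaf)) = mkChain (_ ∷ below) (vt ∷ linked) leaf

  hangingVertices : ∀ {v} → Hanging v → List (Fin n)
  hangingVertices h = Chain.below (extend h)

  hangingBottom : ∀ {v} → Hanging v → Fin n
  hangingBottom h = Chain.bottom (extend h)

  join : ∀ {v} (h₁ h₂ : Hanging v) → Unique (hangingVertices h₁ ʳ++ v ∷ hangingVertices h₂) → Path F
  join {v} h₁ h₂ = toPath F (hangingBottom h₁) (init⁺ t₁ b₁ ʳ++ v ∷ init⁺ t₂ b₂) (hangingBottom h₂)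
    (ʳ++-∷-ends t₁ b₁ v t₂ b₂)
    (Linked-ʳ++ (Adj-sym F) (hangingVertices h₁) (Chain.linked (extend h₁)) (Chain.linked (extend h₂)))
    where
    t₁ = Hanging.top h₁
    t₂ = Hanging.top h₂
    b₁ = Chain.below (Hanging.chain h₁)
    b₂ = Chain.below (Hanging.chain h₂)

  record SubtreePacking (v : Fin n) : Set where
    field
      paths   : List (Path F)
      pending : List (Chain v)
    used : List (Fin n)
    used = pathVertices F paths ++ concatMap chainVertices pending
    field
      paths-V₁       : All (EndsInV₁ F) paths
      pending≤1      : length pending ≤ 1
      used-unique    : Unique used
      used-below     : ∀ {x} → x ∈ used → Descendant v x
      leaves-covered : ∀ {w} → Leaf F w → w ≢ r → Descendant v w →
                       Any (IsEndOf F w) paths ⊎ Any (λ C → w ≡ Chain.bottom C) pending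

  record ForestPacking (v : Fin n) (cs : List (Fin n)) : Set where
    field
      paths   : List (Path F)
      hanging : List (Hanging v)
    used : List (Fin n)
    used = pathVertices F paths ++ concatMap hangingVertices hanging
    field
      paths-V₁       : All (EndsInV₁ F) paths
      hanging≤       : length hanging ≤ length cs
      used-unique    : Unique used
      used-below     : ∀ {x} → x ∈ used → Any (λ c → Descendant c x) cs
      leaves-covered : ∀ {w} → Leaf F w → w ≢ r → Any (λ c → Descendant c w) cs →
                       Any (IsEndOf F w) paths ⊎ Any (λ h → w ≡ hangingBottom h) hanging

  empty-forest : ∀ {v} → ForestPacking v []
  empty-forest = record
    { paths = [] ; hanging = [] ; paths-V₁ = [] ; hanging≤ = z≤n ; used-unique = []
    ; used-below = λ () ; leaves-covered = λ _ _ () }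

  merge : ∀ {v c cs} → Child v c → All (c ≢_) cs → All (Child v) cs →
          SubtreePacking c → ForestPacking v cs → ForestPacking v (c ∷ cs)
  merge {v} {c} {cs} vc c∉cs vcs S P = record
    { paths          = S.paths ++ P.paths
    ; hanging        = map lift S.pending ++ P.hanging
    ; paths-V₁       = All.++⁺ S.paths-V₁ P.paths-V₁
    ; hanging≤       = hanging≤
    ; used-unique    = Unique-resp-↭ (↭-sym used↭) (Unique.++⁺ S.used-unique P.used-unique separated)
    ; used-below     = [ here ∘ S.used-below , there ∘ P.used-below ]′ ∘ ∈-++⁻ S.used ∘ ∈-resp-↭ used↭
    ; leaves-covered = λ
      { w-leaf w≢r (here cw) →
          Sum.map Any.++⁺ˡ (Any.++⁺ˡ ∘ Any.map⁺) (S.leaves-covered w-leaf w≢r cw)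
      ; w-leaf w≢r (there ∃c) →
          Sum.map (Any.++⁺ʳ S.paths) (Any.++⁺ʳ _) (P.leaves-covered w-leaf w≢r ∃c)
      }
    }
    where
    module S = SubtreePacking S
    module P = ForestPacking P

    lift : Chain c → Hanging v
    lift = mkHanging (child-adj vc)

    hanging≤ : length (map lift S.pending ++ P.hanging) ≤ suc (length cs)
    hanging≤ = begin
      length (map lift S.pending ++ P.hanging)          ≡⟨ length-++ (map lift S.pending) ⟩
      length (map lift S.pending) + length P.hanging    ≡⟨ cong (_+ _) (length-map lift S.pending) ⟩
      length S.pending + length P.hanging               ≤⟨ +-mono-≤ S.pending≤1 P.hanging≤ ⟩
      suc (length cs)                                   ∎
      where open ≤-Reasoning

    separated : Disjoint S.used P.used
    separated (x∈S , x∈P) with c′ , c′∈cs , c′x ← find (P.used-below x∈P) =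
      All.lookup c∉cs c′∈cs (descendant-unique (S.used-below x∈S) c′x
        (trans (child-depth vc) (sym (child-depth (All.lookup vcs c′∈cs)))))

    used↭ : pathVertices F (S.paths ++ P.paths) ++ concatMap hangingVertices (map lift S.pending ++ P.hanging)
            ↭ S.used ++ P.used
    used↭ = begin
      pathVertices F (S.paths ++ P.paths) ++ concatMap hangingVertices (map lift S.pending ++ P.hanging)
        ≡⟨ cong₂ _++_ (concatMap-++ vertices S.paths P.paths)
                      (trans (concatMap-++ hangingVertices (map lift S.pending) P.hanging)
                             (cong (_++ _) (concatMap-map hangingVertices lift S.pending))) ⟩
      (pathVertices F S.paths ++ pathVertices F P.paths) ++
      (concatMap chainVertices S.pending ++ concatMap hangingVertices P.hanging)
        ↭⟨ ++-interchange (pathVertices F S.paths) _ _ _ ⟩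
      S.used ++ P.used
        ∎
      where open PermutationReasoning

  mergeAll : ∀ {v cs} → Unique cs → All (Child v) cs → All SubtreePacking cs → ForestPacking v cs
  mergeAll []              []          []       = empty-forest
  mergeAll (c∉cs ∷ u-cs) (vc ∷ vcs) (S ∷ Ss) = merge vc c∉cs vcs S (mergeAll u-cs vcs Ss)

  module Closing {v : Fin n} (P : ForestPacking v (children v)) where
    open ForestPacking P

    Unique-v∷used : Unique (v ∷ used)
    Unique-v∷used =
      All.tabulate (λ x∈ v≡x → proj₂ (proper-descendant (used-below x∈)) (sym v≡x)) ∷ used-unique

    v∷used-below : ∀ {x} → x ∈ v ∷ used → Descendant v x
    v∷used-below (here refl) = ε
    v∷used-below (there x∈) = proj₁ (proper-descendant (used-below x∈))

    hanging-at-leaf : Leaf F v → v ≢ r → length hanging ≡ 0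
    hanging-at-leaf v-leaf v≢r = n≤0⇒n≡0 (subst (length hanging ≤_) (leaf-childless v-leaf v≢r) hanging≤)

    covered-below : ∀ {w} → Leaf F w → w ≢ r → Descendant v w →
      w ≡ v ⊎ (Any (IsEndOf F w) paths ⊎ Any (λ h → w ≡ hangingBottom h) hanging)
    covered-below w-leaf w≢r vw = Sum.map₂ (leaves-covered w-leaf w≢r) (descendant-split vw)

  close : ∀ {v} → ForestPacking v (children v) → SubtreePacking v
  close {v} P@record { paths = ps ; hanging = [] } with deg F v ℕ.≟ 1
  ... | yes v-leaf = record
    { paths          = ps
    ; pending        = mkChain [] [-] v-leaf ∷ []
    ; paths-V₁       = paths-V₁
    ; pending≤1      = ≤-refl
    ; used-unique    = Unique-resp-↭ (↭-sym (shift v (pathVertices F ps) [])) Unique-v∷used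
    ; used-below     = v∷used-below ∘ ∈-resp-↭ (shift v (pathVertices F ps) [])
    ; leaves-covered = λ w-leaf w≢r vw →
        [ (λ { refl → inj₂ (here refl) }) , Sum.map₂ (λ ()) ]′ (covered-below w-leaf w≢r vw)
    }
    where
    open ForestPacking P
    open Closing P
  ... | no ¬v-leaf = record
    { paths          = ps
    ; pending        = []
    ; paths-V₁       = paths-V₁
    ; pending≤1      = z≤n
    ; used-unique    = used-unique
    ; used-below     = proj₁ ∘ proper-descendant ∘ used-below
    ; leaves-covered = λ w-leaf w≢r vw →
        [ (λ { refl → contradiction w-leaf ¬v-leaf }) , Sum.map₂ (λ ()) ]′ (covered-below w-leaf w≢r vw)
    }
    where
    open ForestPacking P
    open Closing P
  close {v} P@record { paths = ps ; hanging = h ∷ [] } = record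
    { paths          = ps
    ; pending        = extend h ∷ []
    ; paths-V₁       = paths-V₁
    ; pending≤1      = ≤-refl
    ; used-unique    = Unique-resp-↭ (↭-sym (shift v (pathVertices F ps) _)) Unique-v∷used
    ; used-below     = v∷used-below ∘ ∈-resp-↭ (shift v (pathVertices F ps) _)
    ; leaves-covered = λ w-leaf w≢r vw →
        [ (λ { refl → contradiction (hanging-at-leaf w-leaf w≢r) λ () })
        , Sum.map₂ (λ { (here w≡b) → here w≡b })
        ]′
        (covered-below w-leaf w≢r vw)
    }
    where
    open ForestPacking P
    open Closing P
  close {v} P@record { paths = ps ; hanging = h₁ ∷ h₂ ∷ [] } = record
    { paths          = J ∷ ps
    ; pending        = []
    ; paths-V₁       = (Chain.leaf (extend h₁) , Chain.leaf (extend h₂)) ∷ paths-V₁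
    ; pending≤1      = z≤n
    ; used-unique    = subst (λ zs → Unique ((zs ++ pv) ++ [])) (sym J-shape) Unique-used′
    ; used-below     = v∷used-below ∘ ∈-resp-↭ used′↭ ∘ subst (λ zs → _ ∈ (zs ++ pv) ++ []) J-shape
    ; leaves-covered = λ w-leaf w≢r vw → inj₁
        ([ (λ { refl → contradiction (hanging-at-leaf w-leaf w≢r) λ () })
         , [ there , (λ { (here w≡b₁) → here (inj₁ w≡b₁) ; (there (here w≡b₂)) → here (inj₂ w≡b₂) }) ]′
         ]′ (covered-below w-leaf w≢r vw))
    }
    where
    open ForestPacking P
    open Closing P
    pv  = pathVertices F ps
    hv₁ = hangingVertices h₁
    hv₂ = hangingVertices h₂
    L   = hv₁ ʳ++ v ∷ hv₂

    used′↭ : (L ++ pv) ++ [] ↭ v ∷ used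
    used′↭ = begin
      (L ++ pv) ++ []             ≡⟨ ++-identityʳ _ ⟩
      L ++ pv                     ↭⟨ ++-comm L pv ⟩
      pv ++ L                     ↭⟨ ++⁺ˡ pv (ʳ++-∷-↭ hv₁ v hv₂) ⟩
      pv ++ v ∷ hv₁ ++ hv₂        ↭⟨ shift v pv _ ⟩
      v ∷ pv ++ hv₁ ++ hv₂        ≡⟨ cong (λ zs → v ∷ pv ++ hv₁ ++ zs) (++-identityʳ hv₂) ⟨
      v ∷ pv ++ hv₁ ++ hv₂ ++ []  ∎
      where open PermutationReasoning

    Unique-used′ : Unique ((L ++ pv) ++ [])
    Unique-used′ = Unique-resp-↭ (↭-sym used′↭) Unique-v∷used

    J : Path F
    J = join h₁ h₂ (proj₁ (Unique-++⁻ L (proj₁ (Unique-++⁻ (L ++ pv) Unique-used′))))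

    J-shape : vertices J ≡ L
    J-shape = ʳ++-∷-ends (Hanging.top h₁) (Chain.below (Hanging.chain h₁))
                         v (Hanging.top h₂) (Chain.below (Hanging.chain h₂))
  close {v} P@record { hanging = _ ∷ _ ∷ _ ∷ _ } =
    contradiction (≤-trans (ForestPacking.hanging≤ P) (length-children≤2 v)) λ { (s≤s (s≤s ())) }

  pack : ∀ f v → height < depth v + f → SubtreePacking v
  pack zero v height< =
    contradiction (depth≤height v) (<⇒≱ (subst (height <_) (+-identityʳ (depth v)) height<))
  pack (suc f) v height< =
    close (mergeAll (Unique-children v) (All-Child-children v) (All.tabulate λ c∈ → pack f _ (deeper c∈)))
    where
    deeper : ∀ {c} → c ∈ children v → height < depth c + f
    deeper c∈ = subst (height <_)
      (trans (+-suc (depth v) f) (cong (_+ f) (sym (child-depth (All.lookup (All-Child-children v) c∈)))))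
      height<

  covering-paths : Σ[ Ps ∈ List (Path F) ] All (EndsInV₁ F) Ps × Unique (pathVertices F Ps) ×
            (∀ {w} → Leaf F w → w ≢ r → Any (IsEndOf F w) Ps)
  covering-paths with pack (suc height) r (≤-trans (n<1+n height) (m≤n+m (suc height) (depth r)))
  ... | S@record { paths = ps ; pending = [] } =
    ps , paths-V₁ , proj₁ (Unique-++⁻ (pathVertices F ps) used-unique) ,
    λ w-leaf w≢r → [ id , (λ ()) ]′ (leaves-covered w-leaf w≢r (root-descendant _))
    where open SubtreePacking S
  ... | S@record { paths = ps ; pending = mkChain [] _ _ ∷ [] } =
    ps , paths-V₁ , proj₁ (Unique-++⁻ (pathVertices F ps) used-unique) ,
    λ w-leaf w≢r → [ id , (λ { (here w≡r) → contradiction w≡r w≢r }) ]′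
                   (leaves-covered w-leaf w≢r (root-descendant _))
    where open SubtreePacking S
  ... | S@record { paths = ps ; pending = mkChain (x ∷ xs) linked x-leaf ∷ [] } =
    J ∷ ps , (r-leaf , x-leaf) ∷ paths-V₁ , subst (λ zs → Unique (zs ++ pv)) (sym J-shape) Unique-C++pv ,
    λ w-leaf w≢r → [ there , (λ { (here w≡b) → here (inj₂ w≡b) }) ]′
                   (leaves-covered w-leaf w≢r (root-descendant _))
    where
    open SubtreePacking S
    pv = pathVertices F ps
    C  = r ∷ x ∷ xs

    Unique-C++pv : Unique (C ++ pv)
    Unique-C++pv = Unique-resp-↭
      (↭-trans (++-comm pv (C ++ [])) (↭-reflexive (cong (_++ pv) (++-identityʳ C)))) used-unique

    J-shape : (r ∷ init⁺ x xs) ∷ʳ last⁺ x xs ≡ C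
    J-shape = cong (r ∷_) (init⁺-∷ʳ-last⁺ x xs)

    J : Path F
    J = toPath F r (init⁺ x xs) (last⁺ x xs) J-shape linked (proj₁ (Unique-++⁻ C Unique-C++pv))
  ... | S@record { pending = _ ∷ _ ∷ _ } = contradiction (SubtreePacking.pending≤1 S) λ { (s≤s ()) }

lemma3 : (n : ℕ) (F : Graph n) → Connected F → MaxDegreeAtMost F 3 →
    2 ≤ length (V₁ F) → DisjointV₁Paths F ⌊ length (V₁ F) /2⌋
lemma3 n F connected maxDeg≤3 2≤|V₁|
  with r , r∈V₁ ← 0<length⇒∃∈ (≤-trans (n≤1+n 1) 2≤|V₁|)
  with Ps , ends , disjoint , covered ←
         GreedyPacking.covering-paths F connected maxDeg≤3 r (∈-V₁⇒Leaf F r∈V₁) =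
  covering-all-leaves-but-one⇒DisjointV₁Paths F r Ps ends disjoint covered
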